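{- Let $Q$ be a positive integer, let $x$ be the least common multiple of $1,2,\dots,Q$, and let $X=(X_{mn})_{m,n=1}^x$ with $X_{mn}=\sum_{q=1}^Q c_q(m-n)$ and $Y=(Y_{mn})_{m,n=1}^x$ with $Y_{mn}=\sum_{q=1}^Q S(m,n;q)$. Then $Y^2=xX$.
   Context: For a positive integer $q$ and any integer $n$, the Ramanujan sum is $c_q(n)=\sum_{1\le k\le q,\ \gcd(k,q)=1}\exp(2\pi i kn/q)$. For integers $m,n$, the Kloosterman sum is $S(m,n;q)=\sum_{1\le k\le q,\ \gcd(k,q)=1}\exp\bigl(\frac{2\pi i}{q}(mk+nk^*)\bigr)$, where $k^*$ denotes an inverse of $k$ modulo $q$. -}

module Defs where

open import Level using (Level)
open import Data.Bool using (Bool; if_then_else_)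
open import Data.Nat using (ℕ; zero; suc)
import Data.Nat as ℕ
open import Data.Nat.LCM using (lcm)
open import Data.Nat.Coprimality using (coprime?)
open import Data.Integer using (ℤ; +_; _%ℕ_)
import Data.Integer as ℤ
open import Relation.Nullary.Decidable using (⌊_⌋)
open import Algebra.Bundles using (CommutativeRing)
open import Relation.Nullary using (¬_)
open import Data.Sum using (_⊎_)

lcmUpTo : ℕ → ℕ
lcmUpTo zero    = 1
lcmUpTo (suc n) = lcm (suc n) (lcmUpTo n)

-- a modular inverse of k modulo q, found by search over j = q, q-1, ..., 1
-- (returns some j in [1,q] with k*j ≡ 1 (mod q) whenever gcd(k,q) = 1)
invMod : ℕ → ℕ → ℕ
invMod zero    k = 0
invMod (suc q) k = go (suc q)
  where
  go : ℕ → ℕ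
  go zero    = 0
  go (suc j) = if ((k ℕ.* suc j) ℕ.% suc q) ℕ.≡ᵇ (1 ℕ.% suc q) then suc j else go j

module Sums {c ℓ : Level} (R : CommutativeRing c ℓ) where
  open CommutativeRing R

  pow : Carrier → ℕ → Carrier
  pow a zero    = 1#
  pow a (suc n) = a * pow a n

  fromℕ : ℕ → Carrier
  fromℕ zero    = 0#
  fromℕ (suc n) = 1# + fromℕ n

  ΣR : ℕ → (ℕ → Carrier) → Carrier
  ΣR zero    f = 0#
  ΣR (suc n) f = ΣR n f + f (suc n)

  IsPrimitiveRoot : ℕ → Carrier → Set ℓ
  IsPrimitiveRoot x ζ = (pow ζ x ≈ 1#) Data.Product.× (∀ d → 0 ℕ.< d → d ℕ.< x → ¬ (pow ζ d ≈ 1#))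
    where import Data.Product

  IsIntegralDomain : Set (c Level.⊔ ℓ)
  IsIntegralDomain = (¬ (1# ≈ 0#)) Data.Product.× (∀ a b → a * b ≈ 0# → (a ≈ 0#) ⊎ (b ≈ 0#))
    where import Data.Product

  module _ (x : ℕ) (ζ : Carrier) where
    -- eq q a = exp(2πi a / q), realised as ζ^((a mod q) * (x / q)) where ζ = exp(2πi / x), q ∣ x
    eq : ℕ → ℤ → Carrier
    eq zero    a = 1#
    eq (suc q) a = pow ζ ((a %ℕ suc q) ℕ.* (x ℕ./ suc q))

    ramanujan : ℕ → ℤ → Carrier
    ramanujan q n = ΣR q (λ k → if ⌊ coprime? k q ⌋ then eq q (n ℤ.* + k) else 0#)

    kloosterman : ℕ → ℕ → ℕ → Carrier
    kloosterman m n q =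
      ΣR q (λ k → if ⌊ coprime? k q ⌋ then eq q (+ (m ℕ.* k ℕ.+ n ℕ.* invMod q k)) else 0#)

  Xmat : Carrier → ℕ → ℕ → ℕ → Carrier
  Xmat ζ Q m n = ΣR Q (λ q → ramanujan (lcmUpTo Q) ζ q (+ m ℤ.- + n))

  Ymat : Carrier → ℕ → ℕ → ℕ → Carrier
  Ymat ζ Q m n = ΣR Q (λ q → kloosterman (lcmUpTo Q) ζ m n q)

  Ysq : Carrier → ℕ → ℕ → ℕ → Carrier
  Ysq ζ Q m n = ΣR (lcmUpTo Q) (λ l → Ymat ζ Q m l * Ymat ζ Q l n)

{-# OPTIONS --safe #-}
module Submission where

-- Write x = lcm(1,…,Q) and e_q(a) = ζ^(a·x/q). Expanding (Y²)_{mn} and summing over the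
-- middle index l first, the term indexed by (q,k) and (r,j) becomes ζ^C · Σ_{l=1}^{x} ζ^(l·A)
-- with A = k*·x/q + j·x/r: a geometric sum, equal to x when x ∣ A and to 0 otherwise, because
-- ζ is a primitive x-th root of unity in an integral domain. For k* and j coprime to q and r,
-- x ∣ A forces r = q and j ≡ −k* (mod q), so for each (q,k) exactly one (r,j) survives; for it
-- j* ≡ −k, which turns ζ^C into e_q((m−n)k). Summing over (q,k) gives x·X_{mn}.

open import Defs
open import Level using (Level)
open import Data.Nat using (ℕ; _≤_; NonZero)
open import Algebra.Bundles using (CommutativeRing)

module Arithmetic where

  open import Data.Bool using (if_then_else_; true; false; T)
  open import Data.Empty using (⊥-elim)
  open import Data.List using (_∷_; [])
  open import Data.Nat
  open import Data.Nat.Properties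
  open import Data.Nat.DivMod
  open import Data.Nat.Divisibility
  open import Data.Nat.Coprimality as Coprime using (Coprime; coprime-Bézout; coprime-divisor)
  open import Data.Nat.GCD using (module Bézout)
  open import Data.Nat.LCM using (lcm; m∣lcm[m,n]; n∣lcm[m,n]; lcm-least)
  open import Data.Nat.Tactic.RingSolver using (solve)
  open import Data.Product using (∃; _×_; _,_)
  open import Data.Sum using (inj₁; inj₂)
  open import Data.Unit using (tt)
  open import Relation.Binary.PropositionalEquality
    using (_≡_; refl; sym; trans; cong; cong₂; subst; module ≡-Reasoning)
  open import Relation.Nullary using (contradiction)

  import Data.Integer as ℤ
  import Data.Integer.Properties as ℤP
  import Data.Integer.Divisibility.Signed as ℤ∣
  import Data.Integer.Tactic.RingSolver as ℤSolver
  open ℤ using (ℤ; +_; _⊖_)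
  open import Data.Integer.DivMod using (_%ℕ_; _/ℕ_; n%ℕd<d; a≡a%ℕn+[a/ℕn]*n)
  open ℤ∣ using () renaming (_∣_ to _∣ℤ_)

  lcm-nonZero : ∀ m n .{{_ : NonZero m}} .{{_ : NonZero n}} → NonZero (lcm m n)
  lcm-nonZero m n = ≢-nonZero λ lcm≡0 → ≢-nonZero⁻¹ (m * n) {{m*n≢0 m n}}
    (0∣⇒≡0 (subst (_∣ m * n) lcm≡0 (lcm-least {m} (m∣m*n n) (n∣m*n m))))

  lcmUpTo-nonZero : ∀ Q → NonZero (lcmUpTo Q)
  lcmUpTo-nonZero zero    = _
  lcmUpTo-nonZero (suc Q) = lcm-nonZero (suc Q) (lcmUpTo Q) {{_}} {{lcmUpTo-nonZero Q}}

  ∣lcmUpTo : ∀ {q} Q → 1 ≤ q → q ≤ Q → q ∣ lcmUpTo Q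
  ∣lcmUpTo zero    1≤q q≤0   = contradiction q≤0 (<⇒≱ 1≤q)
  ∣lcmUpTo (suc Q) 1≤q q≤1+Q with m≤n⇒m<n∨m≡n q≤1+Q
  ... | inj₁ q<1+Q = ∣-trans (∣lcmUpTo Q 1≤q (s≤s⁻¹ q<1+Q)) (n∣lcm[m,n] (suc Q) (lcmUpTo Q))
  ... | inj₂ refl  = m∣lcm[m,n] (suc Q) (lcmUpTo Q)

  %-absorbʳ-* : ∀ m n d .{{_ : NonZero d}} → (m * (n % d)) % d ≡ (m * n) % d
  %-absorbʳ-* m n d = begin
    (m * (n % d)) % d           ≡⟨ %-distribˡ-* m (n % d) d ⟩
    ((m % d) * (n % d % d)) % d ≡⟨ cong (λ r → ((m % d) * r) % d) (m%n%n≡m%n n d) ⟩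
    ((m % d) * (n % d)) % d     ≡⟨ %-distribˡ-* m n d ⟨
    (m * n) % d                 ∎
    where open ≡-Reasoning

  -- invMod runs a search loop local to Defs, which cannot be named here; invSearch is a
  -- copy of it, and the type of loop≡invSearch is left to unification, which recovers the
  -- loop from the use in invMod≡invSearch.
  invSearch : ℕ → ℕ → ℕ → ℕ
  invSearch d k zero    = 0
  invSearch d k (suc j) = if (k * suc j) % suc d ≡ᵇ 1 % suc d then suc j else invSearch d k j

  loop≡invSearch : (d k j : ℕ) → _ ≡ invSearch d k j

  invMod≡invSearch : ∀ d k → invMod (suc d) k ≡ invSearch d k (suc d)
  invMod≡invSearch zero    k = refl
  invMod≡invSearch (suc d) k with suc d
  ... | D = cong (if (k * suc D) % suc D ≡ᵇ 1 then suc D else_)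
              (cong (if (k * D) % suc D ≡ᵇ 1 then D else_) (loop≡invSearch D k d))

  loop≡invSearch d k zero    = refl
  loop≡invSearch d k (suc j) =
    cong (if (k * suc j) % suc d ≡ᵇ 1 % suc d then suc j else_) (loop≡invSearch d k j)

  invSearch-inverse : ∀ d k B {j} → j ≤ B → (k * j) % suc d ≡ 1 % suc d →
                      (k * invSearch d k B) % suc d ≡ 1 % suc d
  invSearch-inverse d k zero    z≤n  kj≡1 = kj≡1
  invSearch-inverse d k (suc B) j≤1+B kj≡1 with (k * suc B) % suc d ≡ᵇ 1 % suc d in test
  ... | true  = ≡ᵇ⇒≡ _ _ (subst T (sym test) tt)
  ... | false with m≤n⇒m<n∨m≡n j≤1+B
  ...   | inj₁ j<1+B = invSearch-inverse d k B (s≤s⁻¹ j<1+B) kj≡1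
  ...   | inj₂ refl  = ⊥-elim (subst T test (≡⇒≡ᵇ _ _ kj≡1))

  inverse-exists : ∀ {d k} → Coprime k (suc d) → ∃ λ a → (k * a) % suc d ≡ 1 % suc d
  inverse-exists {d} {k} k⊥D with coprime-Bézout k⊥D
  ... | Bézout.+- a b 1+bD≡ak = a , (begin
    (k * a) % suc d         ≡⟨ cong (_% suc d) (trans (*-comm k a) (sym 1+bD≡ak)) ⟩
    (1 + b * suc d) % suc d ≡⟨ [m+kn]%n≡m%n 1 b (suc d) ⟩
    1 % suc d               ∎)
    where open ≡-Reasoning
  ... | Bézout.-+ a b 1+ak≡bD = d * a , (begin
    (k * (d * a)) % suc d                 ≡⟨ [m+kn]%n≡m%n (k * (d * a)) b (suc d) ⟨
    (k * (d * a) + b * suc d) % suc d     ≡⟨ cong (λ t → (k * (d * a) + t) % suc d) (sym 1+ak≡bD) ⟩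
    (k * (d * a) + (1 + a * k)) % suc d   ≡⟨ cong (_% suc d) identity ⟩
    (1 + (a * k) * suc d) % suc d         ≡⟨ [m+kn]%n≡m%n 1 (a * k) (suc d) ⟩
    1 % suc d                             ∎)
    where
    open ≡-Reasoning
    identity : k * (d * a) + (1 + a * k) ≡ 1 + (a * k) * suc d
    identity = solve (k ∷ d ∷ a ∷ [])

  invMod-inverse : ∀ {d k} → Coprime k (suc d) → (k * invMod (suc d) k) % suc d ≡ 1 % suc d
  invMod-inverse {d} {k} k⊥D with inverse-exists k⊥D
  ... | a , ka≡1 rewrite invMod≡invSearch d k =
    invSearch-inverse d k (suc d) (m%n≤n a (suc d)) (trans (%-absorbʳ-* k a (suc d)) ka≡1)

  inverse⇒coprime : ∀ {n k i} .{{_ : NonZero n}} → (k * i) % n ≡ 1 % n → Coprime i n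
  inverse⇒coprime {n} {k} {i} ki≡1 (e∣i , e∣n) =
    ∣1⇒≡1 (∣n∣m%n⇒∣m e∣n (subst (_ ∣_) ki≡1 (%-presˡ-∣ (∣n⇒∣m*n k e∣i) e∣n)))

  invMod-coprime : ∀ {d k} → Coprime k (suc d) → Coprime (invMod (suc d) k) (suc d)
  invMod-coprime {k = k} k⊥D = inverse⇒coprime {k = k} (invMod-inverse k⊥D)

  ∣∧<⇒≡0 : ∀ {d n} → d ∣ n → n < d → n ≡ 0
  ∣∧<⇒≡0 {n = zero}  _   _   = refl
  ∣∧<⇒≡0 {n = suc _} d∣n n<d = contradiction d∣n (>⇒∤ n<d)

  <∧∣⊖⇒≡ : ∀ {d m n} → m < d → n < d → (+ d) ∣ℤ (m ⊖ n) → m ≡ n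
  <∧∣⊖⇒≡ {d} {m} {n} m<d n<d d∣m⊖n = ℤP.+-injective (ℤP.i-j≡0⇒i≡j (+ m) (+ n) (begin
    + m ℤ.- + n ≡⟨ ℤP.[+m]-[+n]≡m⊖n m n ⟩
    m ⊖ n       ≡⟨ ℤP.∣i∣≡0⇒i≡0 ∣m⊖n∣≡0 ⟩
    + 0         ∎))
    where
    open ≡-Reasoning
    ∣m⊖n∣≡0 : ℤ.∣ m ⊖ n ∣ ≡ 0
    ∣m⊖n∣≡0 = ∣∧<⇒≡0 (ℤ∣.∣⇒∣ᵤ d∣m⊖n) (≤-<-trans (ℤP.∣m⊝n∣≤m⊔n m n) (⊔-lub m<d n<d))

  ≤∧∣⊖⇒≡ : ∀ {d m n} → 1 ≤ m → m ≤ d → 1 ≤ n → n ≤ d → (+ d) ∣ℤ (m ⊖ n) → m ≡ n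
  ≤∧∣⊖⇒≡ {m = suc m} {suc n} _ m<d _ n<d d∣m⊖n =
    cong suc (<∧∣⊖⇒≡ m<d n<d (subst (_ ∣ℤ_) (ℤP.[1+m]⊖[1+n]≡m⊖n m n) d∣m⊖n))

  %ℕ≡⇒∣- : ∀ d .{{_ : NonZero d}} a b → a %ℕ d ≡ b %ℕ d → (+ d) ∣ℤ (a ℤ.- b)
  %ℕ≡⇒∣- d a b a≡b = ℤ∣.divides (a /ℕ d ℤ.- b /ℕ d) (begin
    a ℤ.- b
      ≡⟨ cong₂ ℤ._-_ (a≡a%ℕn+[a/ℕn]*n a d) (a≡a%ℕn+[a/ℕn]*n b d) ⟩
    (+ (a %ℕ d) ℤ.+ A ℤ.* + d) ℤ.- (+ (b %ℕ d) ℤ.+ B ℤ.* + d)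
      ≡⟨ cong (λ r → (+ r ℤ.+ A ℤ.* + d) ℤ.- (+ (b %ℕ d) ℤ.+ B ℤ.* + d)) a≡b ⟩
    (+ (b %ℕ d) ℤ.+ A ℤ.* + d) ℤ.- (+ (b %ℕ d) ℤ.+ B ℤ.* + d)
      ≡⟨ cancel-remainder (+ (b %ℕ d)) A B (+ d) ⟩
    (A ℤ.- B) ℤ.* + d ∎)
    where
    open ≡-Reasoning
    A = a /ℕ d
    B = b /ℕ d
    cancel-remainder : ∀ r A B d → (r ℤ.+ A ℤ.* d) ℤ.- (r ℤ.+ B ℤ.* d) ≡ (A ℤ.- B) ℤ.* d
    cancel-remainder = ℤSolver.solve-∀

  ∣-⇒%ℕ≡ : ∀ d .{{_ : NonZero d}} a b → (+ d) ∣ℤ (a ℤ.- b) → a %ℕ d ≡ b %ℕ d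
  ∣-⇒%ℕ≡ d a b d∣a-b = <∧∣⊖⇒≡ (n%ℕd<d a d) (n%ℕd<d b d) (subst (_ ∣ℤ_) remainders
    (ℤ∣.∣m∣n⇒∣m-n d∣a-b (ℤ∣.∣n⇒∣m*n (A ℤ.- B) (ℤ∣.∣-refl {+ d}))))
    where
    open ≡-Reasoning
    A = a /ℕ d
    B = b /ℕ d
    drop-quotients : ∀ r s A B d → ((r ℤ.+ A ℤ.* d) ℤ.- (s ℤ.+ B ℤ.* d)) ℤ.- (A ℤ.- B) ℤ.* d ≡ r ℤ.- s
    drop-quotients = ℤSolver.solve-∀
    remainders : (a ℤ.- b) ℤ.- (A ℤ.- B) ℤ.* + d ≡ (a %ℕ d) ⊖ (b %ℕ d)
    remainders = begin
      (a ℤ.- b) ℤ.- (A ℤ.- B) ℤ.* + d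
        ≡⟨ cong₂ (λ u v → (u ℤ.- v) ℤ.- (A ℤ.- B) ℤ.* + d) (a≡a%ℕn+[a/ℕn]*n a d) (a≡a%ℕn+[a/ℕn]*n b d) ⟩
      ((+ (a %ℕ d) ℤ.+ A ℤ.* + d) ℤ.- (+ (b %ℕ d) ℤ.+ B ℤ.* + d)) ℤ.- (A ℤ.- B) ℤ.* + d
        ≡⟨ drop-quotients (+ (a %ℕ d)) (+ (b %ℕ d)) A B (+ d) ⟩
      + (a %ℕ d) ℤ.- + (b %ℕ d)
        ≡⟨ ℤP.[+m]-[+n]≡m⊖n (a %ℕ d) (b %ℕ d) ⟩
      (a %ℕ d) ⊖ (b %ℕ d) ∎

  -- The residue of −a modulo suc d, represented in [1, suc d] (the summation range) rather than [0, d].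
  negMod : ℕ → ℕ → ℕ
  negMod d a = suc d ∸ a % suc d

  negMod-positive : ∀ d a → 1 ≤ negMod d a
  negMod-positive d a = m<n⇒0<n∸m (m%n<n a (suc d))

  negMod-≤ : ∀ d a → negMod d a ≤ suc d
  negMod-≤ d a = m∸n≤m (suc d) (a % suc d)

  ∣+negMod : ∀ d a → suc d ∣ a + negMod d a
  ∣+negMod d a = divides (suc (a / suc d)) (begin
    a + (suc d ∸ r)               ≡⟨ cong (_+ (suc d ∸ r)) (m≡m%n+[m/n]*n a (suc d)) ⟩
    r + t + (suc d ∸ r)           ≡⟨ cong (_+ (suc d ∸ r)) (+-comm r t) ⟩
    t + r + (suc d ∸ r)           ≡⟨ +-assoc t r (suc d ∸ r) ⟩
    t + (r + (suc d ∸ r))         ≡⟨ cong (λ u → t + u) (m+[n∸m]≡n (m%n≤n a (suc d))) ⟩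
    t + suc d                     ≡⟨ +-comm t (suc d) ⟩
    suc (a / suc d) * suc d       ∎)
    where
    open ≡-Reasoning
    r = a % suc d
    t = a / suc d * suc d

  negMod-unique : ∀ d a {j} → 1 ≤ j → j ≤ suc d → suc d ∣ a + j → j ≡ negMod d a
  negMod-unique d a {j} 1≤j j≤D D∣a+j = ≤∧∣⊖⇒≡ 1≤j j≤D (negMod-positive d a) (negMod-≤ d a)
    (subst (_ ∣ℤ_) difference (ℤ∣.∣m∣n⇒∣m-n (ℤ∣.∣ᵤ⇒∣ {i = + (a + j)} D∣a+j)
                                           (ℤ∣.∣ᵤ⇒∣ {i = + (a + negMod d a)} (∣+negMod d a))))
    where
    difference : + (a + j) ℤ.- + (a + negMod d a) ≡ j ⊖ negMod d a
    difference = trans (ℤP.[+m]-[+n]≡m⊖n (a + j) (a + negMod d a)) (ℤP.+-cancelˡ-⊖ a j (negMod d a))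

  coprime-∣+ : ∀ {n a b} → Coprime a n → n ∣ a + b → Coprime b n
  coprime-∣+ {a = a} {b} a⊥n n∣a+b {e} (e∣b , e∣n) =
    a⊥n (∣m+n∣m⇒∣n (subst (e ∣_) (+-comm a b) (∣-trans e∣n n∣a+b)) e∣b , e∣n)

  negMod-coprime : ∀ {d a} → Coprime a (suc d) → Coprime (negMod d a) (suc d)
  negMod-coprime {d} {a} a⊥D = coprime-∣+ a⊥D (∣+negMod d a)

  invMod-inverseℤ : ∀ {d k} → Coprime k (suc d) →
                    (+ suc d) ∣ℤ (+ k ℤ.* + invMod (suc d) k ℤ.- + 1)
  invMod-inverseℤ {d} {k} k⊥D = subst (λ z → _ ∣ℤ (z ℤ.- + 1)) (ℤP.pos-* k (invMod (suc d) k))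
    (%ℕ≡⇒∣- (suc d) (+ (k * invMod (suc d) k)) (+ 1) (invMod-inverse k⊥D))

  invMod-negMod-invMod : ∀ {d k} → Coprime k (suc d) →
                  (+ suc d) ∣ℤ (+ invMod (suc d) (negMod d (invMod (suc d) k)) ℤ.+ + k)
  invMod-negMod-invMod {d} {k} k⊥D = subst (_ ∣ℤ_) (sym (expand (+ i′) (+ k) (+ i) (+ J)))
    (ℤ∣.∣m∣n⇒∣m-n (ℤ∣.∣m∣n⇒∣m-n (ℤ∣.∣n⇒∣m*n (+ k ℤ.* + i′) D∣i+J) (ℤ∣.∣n⇒∣m*n (+ k) D∣Ji′-1))
                  (ℤ∣.∣n⇒∣m*n (+ i′) D∣ki-1))
    where
    i  = invMod (suc d) k
    J  = negMod d i
    i′ = invMod (suc d) J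
    D∣ki-1 : (+ suc d) ∣ℤ (+ k ℤ.* + i ℤ.- + 1)
    D∣ki-1 = invMod-inverseℤ k⊥D
    D∣Ji′-1 : (+ suc d) ∣ℤ (+ J ℤ.* + i′ ℤ.- + 1)
    D∣Ji′-1 = invMod-inverseℤ (negMod-coprime (invMod-coprime k⊥D))
    D∣i+J : (+ suc d) ∣ℤ (+ i ℤ.+ + J)
    D∣i+J = subst (+ suc d ∣ℤ_) (ℤP.pos-+ i J) (ℤ∣.∣ᵤ⇒∣ {+ suc d} {+ (i + J)} (∣+negMod d i))
    expand : ∀ i′ k i J → i′ ℤ.+ k ≡ (k ℤ.* i′) ℤ.* (i ℤ.+ J) ℤ.- k ℤ.* (J ℤ.* i′ ℤ.- + 1) ℤ.- i′ ℤ.* (k ℤ.* i ℤ.- + 1)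
    expand = ℤSolver.solve-∀

  kloosterman-phase : ∀ {d k} m n → Coprime k (suc d) →
    + (m * k + n * invMod (suc d) (negMod d (invMod (suc d) k))) %ℕ suc d ≡ ((+ m ℤ.- + n) ℤ.* + k) %ℕ suc d
  kloosterman-phase {d} {k} m n k⊥D =
    ∣-⇒%ℕ≡ (suc d) (+ (m * k + n * i′)) ((+ m ℤ.- + n) ℤ.* + k)
      (subst (_ ∣ℤ_) (sym difference) (ℤ∣.∣n⇒∣m*n (+ n) (invMod-negMod-invMod k⊥D)))
    where
    open ≡-Reasoning
    i′ = invMod (suc d) (negMod d (invMod (suc d) k))
    factor : ∀ m n k i′ → (m ℤ.* k ℤ.+ n ℤ.* i′) ℤ.- (m ℤ.- n) ℤ.* k ≡ n ℤ.* (i′ ℤ.+ k)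
    factor = ℤSolver.solve-∀
    difference : + (m * k + n * i′) ℤ.- (+ m ℤ.- + n) ℤ.* + k ≡ + n ℤ.* (+ i′ ℤ.+ + k)
    difference = begin
      + (m * k + n * i′) ℤ.- (+ m ℤ.- + n) ℤ.* + k
        ≡⟨ cong (ℤ._- (+ m ℤ.- + n) ℤ.* + k)
                (trans (ℤP.pos-+ (m * k) (n * i′)) (cong₂ ℤ._+_ (ℤP.pos-* m k) (ℤP.pos-* n i′))) ⟩
      (+ m ℤ.* + k ℤ.+ + n ℤ.* + i′) ℤ.- (+ m ℤ.- + n) ℤ.* + k
        ≡⟨ factor (+ m) (+ n) (+ k) (+ i′) ⟩
      + n ℤ.* (+ i′ ℤ.+ + k) ∎

  fractions-∣⇒ : ∀ {x Q R i j} .{{_ : NonZero x}} .{{_ : NonZero Q}} .{{_ : NonZero R}} →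
                 Q ∣ x → R ∣ x → Coprime i Q → Coprime j R →
                 x ∣ i * (x / Q) + j * (x / R) → Q ≡ R × Q ∣ i + j
  fractions-∣⇒ {x} {Q} {R} {i} {j} Q∣x R∣x i⊥Q j⊥R (divides t sum≡tx) = Q≡R , Q∣i+j
    where
    open ≡-Reasoning
    regroup : ∀ a b → a * Q * (i * R) + b * R * (j * Q) ≡ (i * a + j * b) * Q * R
    regroup a b = solve (a ∷ b ∷ Q ∷ R ∷ i ∷ j ∷ [])
    cleared : x * (i * R + j * Q) ≡ x * (t * Q * R)
    cleared = begin
      x * (i * R + j * Q)                       ≡⟨ *-distribˡ-+ x (i * R) (j * Q) ⟩
      x * (i * R) + x * (j * Q)                 ≡⟨ cong₂ (λ u v → u * (i * R) + v * (j * Q)) (m/n*n≡m Q∣x) (m/n*n≡m R∣x) ⟨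
      x / Q * Q * (i * R) + x / R * R * (j * Q) ≡⟨ regroup (x / Q) (x / R) ⟩
      (i * (x / Q) + j * (x / R)) * Q * R       ≡⟨ cong (λ s → s * Q * R) sum≡tx ⟩
      t * x * Q * R                             ≡⟨ solve (t ∷ x ∷ Q ∷ R ∷ []) ⟩
      x * (t * Q * R)                           ∎
    iR+jQ≡tQR : i * R + j * Q ≡ t * Q * R
    iR+jQ≡tQR = *-cancelˡ-≡ _ _ x cleared
    R∣Q : R ∣ Q
    R∣Q = coprime-divisor (Coprime.sym j⊥R)
      (∣m+n∣m⇒∣n (divides (t * Q) iR+jQ≡tQR) (n∣m*n i))
    Q∣R : Q ∣ R
    Q∣R = coprime-divisor (Coprime.sym i⊥Q)
      (∣m+n∣m⇒∣n (subst (Q ∣_) (+-comm (i * R) (j * Q)) (subst (Q ∣_) (sym iR+jQ≡tQR) (∣m⇒∣m*n R (n∣m*n t))))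
                 (n∣m*n j))
    Q≡R : Q ≡ R
    Q≡R = ∣-antisym Q∣R R∣Q
    Q∣i+j : Q ∣ i + j
    Q∣i+j = divides t (*-cancelʳ-≡ (i + j) (t * Q) Q (begin
      (i + j) * Q       ≡⟨ *-distribʳ-+ Q i j ⟩
      i * Q + j * Q     ≡⟨ cong (λ r → i * r + j * Q) Q≡R ⟩
      i * R + j * Q     ≡⟨ iR+jQ≡tQR ⟩
      t * Q * R         ≡⟨ cong (t * Q *_) Q≡R ⟨
      t * Q * Q         ∎))

  ∣⇒fractions-∣ : ∀ {x Q i j} .{{_ : NonZero Q}} → Q ∣ x → Q ∣ i + j → x ∣ i * (x / Q) + j * (x / Q)
  ∣⇒fractions-∣ {x} {Q} {i} {j} Q∣x (divides s i+j≡sQ) = divides s (begin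
    i * (x / Q) + j * (x / Q) ≡⟨ *-distribʳ-+ (x / Q) i j ⟨
    (i + j) * (x / Q)         ≡⟨ cong (_* (x / Q)) i+j≡sQ ⟩
    s * Q * (x / Q)           ≡⟨ *-assoc s Q (x / Q) ⟩
    s * (Q * (x / Q))         ≡⟨ cong (s *_) (m*[n/m]≡n Q∣x) ⟩
    s * x                     ∎)
    where open ≡-Reasoning

  [m%n]*[x/n]%x≡m*[x/n]%x : ∀ m {n x} .{{_ : NonZero n}} .{{_ : NonZero x}} → n ∣ x →
                            (m % n * (x / n)) % x ≡ (m * (x / n)) % x
  [m%n]*[x/n]%x≡m*[x/n]%x m {n} {x} n∣x = sym (begin
    (m * w) % x                         ≡⟨ cong (λ u → (u * w) % x) (m≡m%n+[m/n]*n m n) ⟩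
    ((m % n + m / n * n) * w) % x       ≡⟨ cong (_% x) (*-distribʳ-+ w (m % n) (m / n * n)) ⟩
    (m % n * w + m / n * n * w) % x     ≡⟨ cong (λ u → (m % n * w + u) % x) (*-assoc (m / n) n w) ⟩
    (m % n * w + m / n * (n * w)) % x   ≡⟨ cong (λ u → (m % n * w + m / n * u) % x) (m*[n/m]≡n n∣x) ⟩
    (m % n * w + m / n * x) % x         ≡⟨ [m+kn]%n≡m%n (m % n * w) (m / n) x ⟩
    (m % n * w) % x                     ∎)
    where
    open ≡-Reasoning
    w = x / n

module SumsProperties {c ℓ} (R : CommutativeRing c ℓ) where

  open import Data.Nat as ℕ using (ℕ; zero; suc; z≤n; s≤s)
  import Data.Nat.Properties as ℕ
  open import Data.Product using (_×_; proj₁; proj₂)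
  open import Data.Sum using (inj₁; inj₂)
  open import Function using (_∘_)
  open import Relation.Binary.PropositionalEquality as ≡ using (_≡_; _≢_)
  open import Relation.Nullary using (¬_; contradiction)
  open CommutativeRing R
  open Sums R
  open import Relation.Binary.Reasoning.Setoid setoid

  private
    within : ∀ {n i} → i ℕ.≤ n → i ℕ.≤ suc n
    within = ℕ.m≤n⇒m≤1+n

  ΣR-cong : ∀ n {f g : ℕ → Carrier} → (∀ i → 1 ℕ.≤ i → i ℕ.≤ n → f i ≈ g i) → ΣR n f ≈ ΣR n g
  ΣR-cong zero    f≈g = refl
  ΣR-cong (suc n) f≈g = +-cong (ΣR-cong n λ i 1≤i i≤n → f≈g i 1≤i (within i≤n)) (f≈g (suc n) (s≤s z≤n) ℕ.≤-refl)

  ΣR-zero : ∀ n {f : ℕ → Carrier} → (∀ i → 1 ℕ.≤ i → i ℕ.≤ n → f i ≈ 0#) → ΣR n f ≈ 0#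
  ΣR-zero zero    f≈0 = refl
  ΣR-zero (suc n) f≈0 = trans (+-cong (ΣR-zero n λ i 1≤i i≤n → f≈0 i 1≤i (within i≤n)) (f≈0 (suc n) (s≤s z≤n) ℕ.≤-refl))
                              (+-identityˡ 0#)

  ΣR-one : ∀ n {f : ℕ → Carrier} → (∀ i → 1 ℕ.≤ i → i ℕ.≤ n → f i ≈ 1#) → ΣR n f ≈ fromℕ n
  ΣR-one zero    f≈1 = refl
  ΣR-one (suc n) f≈1 = trans (+-cong (ΣR-one n λ i 1≤i i≤n → f≈1 i 1≤i (within i≤n)) (f≈1 (suc n) (s≤s z≤n) ℕ.≤-refl))
                             (+-comm _ _)

  ΣR-+ : ∀ n (f g : ℕ → Carrier) → ΣR n (λ i → f i + g i) ≈ ΣR n f + ΣR n g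
  ΣR-+ zero    f g = sym (+-identityˡ 0#)
  ΣR-+ (suc n) f g = begin
    ΣR n (λ i → f i + g i) + (f (suc n) + g (suc n)) ≈⟨ +-congʳ (ΣR-+ n f g) ⟩
    (ΣR n f + ΣR n g) + (f (suc n) + g (suc n))       ≈⟨ +-assoc _ _ _ ⟩
    ΣR n f + (ΣR n g + (f (suc n) + g (suc n)))       ≈⟨ +-congˡ (x∙yz≈y∙xz _ _ _) ⟩
    ΣR n f + (f (suc n) + (ΣR n g + g (suc n)))       ≈⟨ +-assoc _ _ _ ⟨
    (ΣR n f + f (suc n)) + (ΣR n g + g (suc n))       ∎
    where open import Algebra.Properties.CommutativeSemigroup +-commutativeSemigroup using (x∙yz≈y∙xz)

  *-distribˡ-ΣR : ∀ n a (f : ℕ → Carrier) → a * ΣR n f ≈ ΣR n (λ i → a * f i)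
  *-distribˡ-ΣR zero    a f = zeroʳ a
  *-distribˡ-ΣR (suc n) a f = trans (distribˡ a (ΣR n f) (f (suc n))) (+-congʳ (*-distribˡ-ΣR n a f))

  *-distribʳ-ΣR : ∀ n a (f : ℕ → Carrier) → ΣR n f * a ≈ ΣR n (λ i → f i * a)
  *-distribʳ-ΣR zero    a f = zeroˡ a
  *-distribʳ-ΣR (suc n) a f = trans (distribʳ a (ΣR n f) (f (suc n))) (+-congʳ (*-distribʳ-ΣR n a f))

  ΣR-swap : ∀ m n (f : ℕ → ℕ → Carrier) → ΣR m (λ i → ΣR n (f i)) ≈ ΣR n (λ j → ΣR m (λ i → f i j))
  ΣR-swap zero    n f = sym (ΣR-zero n λ _ _ _ → refl)
  ΣR-swap (suc m) n f = trans (+-congʳ (ΣR-swap m n f)) (sym (ΣR-+ n (λ j → ΣR m (λ i → f i j)) (f (suc m))))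

  ΣR-delta : ∀ n {i₀} {f : ℕ → Carrier} → 1 ℕ.≤ i₀ → i₀ ℕ.≤ n →
             (∀ i → 1 ℕ.≤ i → i ℕ.≤ n → i ≢ i₀ → f i ≈ 0#) → ΣR n f ≈ f i₀
  ΣR-delta zero    1≤i₀ i₀≤0 f≈0 = contradiction i₀≤0 (ℕ.<⇒≱ 1≤i₀)
  ΣR-delta (suc n) {i₀} 1≤i₀ i₀≤1+n f≈0 with ℕ.m≤n⇒m<n∨m≡n i₀≤1+n
  ... | inj₁ i₀<1+n = trans
    (+-cong (ΣR-delta n 1≤i₀ (ℕ.s≤s⁻¹ i₀<1+n) λ i 1≤i i≤n → f≈0 i 1≤i (within i≤n))
            (f≈0 (suc n) (s≤s z≤n) ℕ.≤-refl λ 1+n≡i₀ → ℕ.<-irrefl (≡.sym 1+n≡i₀) i₀<1+n))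
    (+-identityʳ _)
  ... | inj₂ ≡.refl = trans
    (+-congʳ (ΣR-zero n λ i 1≤i i≤n → f≈0 i 1≤i (within i≤n) λ i≡1+n → ℕ.<-irrefl i≡1+n (s≤s i≤n)))
    (+-identityˡ _)

  ΣR-shift : ∀ n (g : ℕ → Carrier) → ΣR n (λ l → g (suc l)) + g 1 ≈ ΣR n g + g (suc n)
  ΣR-shift zero    g = trans (+-identityˡ _) (sym (+-identityˡ _))
  ΣR-shift (suc n) g = begin
    (ΣR n (λ l → g (suc l)) + g (2 ℕ.+ n)) + g 1 ≈⟨ xy∙z≈xz∙y _ _ _ ⟩
    (ΣR n (λ l → g (suc l)) + g 1) + g (2 ℕ.+ n) ≈⟨ +-congʳ (ΣR-shift n g) ⟩
    (ΣR n g + g (suc n)) + g (2 ℕ.+ n)           ∎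
    where open import Algebra.Properties.CommutativeSemigroup +-commutativeSemigroup using (xy∙z≈xz∙y)

  Σ₂ : ℕ → (ℕ → ℕ → Carrier) → Carrier
  Σ₂ n f = ΣR n (λ q → ΣR q (f q))

  Σ₂-cong : ∀ n {f g : ℕ → ℕ → Carrier} →
            (∀ q k → 1 ℕ.≤ k → k ℕ.≤ q → q ℕ.≤ n → f q k ≈ g q k) → Σ₂ n f ≈ Σ₂ n g
  Σ₂-cong n f≈g = ΣR-cong n λ q _ q≤n → ΣR-cong q λ k 1≤k k≤q → f≈g q k 1≤k k≤q q≤n

  *-distribˡ-Σ₂ : ∀ n a (f : ℕ → ℕ → Carrier) → a * Σ₂ n f ≈ Σ₂ n (λ q k → a * f q k)
  *-distribˡ-Σ₂ n a f = trans (*-distribˡ-ΣR n a _) (ΣR-cong n λ q _ _ → *-distribˡ-ΣR q a (f q))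

  Σ₂-* : ∀ n (f g : ℕ → ℕ → Carrier) → Σ₂ n f * Σ₂ n g ≈ Σ₂ n (λ q k → Σ₂ n (λ r j → f q k * g r j))
  Σ₂-* n f g = begin
    Σ₂ n f * Σ₂ n g                               ≈⟨ *-distribʳ-ΣR n (Σ₂ n g) _ ⟩
    ΣR n (λ q → ΣR q (f q) * Σ₂ n g)              ≈⟨ ΣR-cong n (λ q _ _ → *-distribʳ-ΣR q (Σ₂ n g) (f q)) ⟩
    Σ₂ n (λ q k → f q k * Σ₂ n g)                 ≈⟨ Σ₂-cong n (λ q k _ _ _ → *-distribˡ-Σ₂ n (f q k) g) ⟩
    Σ₂ n (λ q k → Σ₂ n (λ r j → f q k * g r j))   ∎

  ΣR-Σ₂-swap : ∀ m n (F : ℕ → ℕ → ℕ → Carrier) →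
               ΣR m (λ l → Σ₂ n (F l)) ≈ Σ₂ n (λ q k → ΣR m (λ l → F l q k))
  ΣR-Σ₂-swap m n F = trans (ΣR-swap m n _) (ΣR-cong n λ q _ _ → ΣR-swap m q λ l → F l q)

  Σ₂-delta : ∀ n {q₀ k₀} {f : ℕ → ℕ → Carrier} → 1 ℕ.≤ k₀ → k₀ ℕ.≤ q₀ → q₀ ℕ.≤ n →
             (∀ q k → 1 ℕ.≤ k → k ℕ.≤ q → q ℕ.≤ n → ¬ (q ≡ q₀ × k ≡ k₀) → f q k ≈ 0#) →
             Σ₂ n f ≈ f q₀ k₀
  Σ₂-delta n {q₀} 1≤k₀ k₀≤q₀ q₀≤n f≈0 = trans
    (ΣR-delta n (ℕ.≤-trans 1≤k₀ k₀≤q₀) q₀≤n λ q _ q≤n q≢q₀ →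
      ΣR-zero q λ k 1≤k k≤q → f≈0 q k 1≤k k≤q q≤n (q≢q₀ ∘ proj₁))
    (ΣR-delta q₀ 1≤k₀ k₀≤q₀ λ k 1≤k k≤q₀ k≢k₀ → f≈0 q₀ k 1≤k k≤q₀ q₀≤n (k≢k₀ ∘ proj₂))

  pow-+ : ∀ a m n → pow a (m ℕ.+ n) ≈ pow a m * pow a n
  pow-+ a zero    n = sym (*-identityˡ _)
  pow-+ a (suc m) n = trans (*-congˡ (pow-+ a m n)) (sym (*-assoc _ _ _))

  pow-* : ∀ a m n → pow a (m ℕ.* n) ≈ pow (pow a m) n
  pow-* a m zero    = reflexive (≡.cong (pow a) (ℕ.*-zeroʳ m))
  pow-* a m (suc n) = begin
    pow a (m ℕ.* suc n)       ≡⟨ ≡.cong (pow a) (ℕ.*-suc m n) ⟩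
    pow a (m ℕ.+ m ℕ.* n)     ≈⟨ pow-+ a m (m ℕ.* n) ⟩
    pow a m * pow a (m ℕ.* n) ≈⟨ *-congˡ (pow-* a m n) ⟩
    pow a m * pow (pow a m) n ∎

  pow-congˡ : ∀ {a b} n → a ≈ b → pow a n ≈ pow b n
  pow-congˡ zero    a≈b = refl
  pow-congˡ (suc n) a≈b = *-cong a≈b (pow-congˡ n a≈b)

  pow-1# : ∀ n → pow 1# n ≈ 1#
  pow-1# zero    = refl
  pow-1# (suc n) = trans (*-identityˡ _) (pow-1# n)

module RootOfUnity {c ℓ} (R : CommutativeRing c ℓ) (x : ℕ) .{{_ : NonZero x}} (ζ : CommutativeRing.Carrier R)
                   (ζˣ≈1 : CommutativeRing._≈_ R (Sums.pow R ζ x) (CommutativeRing.1# R)) where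

  open CommutativeRing R
  open Sums R

  open import Data.Nat as ℕ using (suc; _%_; _/_)
  import Data.Nat.Properties as ℕ
  open import Data.Nat.DivMod using (m≡m%n+[m/n]*n; [m+kn]%n≡m%n; m%n<n)
  open import Data.Nat.Divisibility using (_∣_; ∣n⇒∣m*n; n∣m⇒m%n≡0; m%n≡0⇒n∣m)
  open import Data.Integer using (+_)
  open import Data.Product using (_,_)
  open import Data.Sum using ([_,_])
  open import Function using (id)
  open import Relation.Binary.PropositionalEquality as ≡ using (_≡_)
  open import Relation.Nullary using (¬_; contradiction)
  open import Algebra.Properties.Ring ring using (+-cancelʳ; [y-z]x≈yx-zx; x∙y⁻¹≈ε⇒x≈y)
  open import Relation.Binary.Reasoning.Setoid setoid
  open SumsProperties R
  open Arithmetic using ([m%n]*[x/n]%x≡m*[x/n]%x)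

  pow-% : ∀ u → pow ζ u ≈ pow ζ (u % x)
  pow-% u = begin
    pow ζ u                               ≡⟨ ≡.cong (pow ζ) u≡r+xt ⟩
    pow ζ (u % x ℕ.+ x ℕ.* (u / x))       ≈⟨ pow-+ ζ (u % x) (x ℕ.* (u / x)) ⟩
    pow ζ (u % x) * pow ζ (x ℕ.* (u / x)) ≈⟨ *-congˡ (pow-* ζ x (u / x)) ⟩
    pow ζ (u % x) * pow (pow ζ x) (u / x) ≈⟨ *-congˡ (trans (pow-congˡ (u / x) ζˣ≈1) (pow-1# (u / x))) ⟩
    pow ζ (u % x) * 1#                    ≈⟨ *-identityʳ _ ⟩
    pow ζ (u % x)                         ∎
    where
    u≡r+xt : u ≡ u % x ℕ.+ x ℕ.* (u / x)
    u≡r+xt = ≡.trans (m≡m%n+[m/n]*n u x) (≡.cong (u % x ℕ.+_) (ℕ.*-comm (u / x) x))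

  pow-cong-% : ∀ {u v} → u % x ≡ v % x → pow ζ u ≈ pow ζ v
  pow-cong-% {u} {v} u≡v = trans (pow-% u) (trans (reflexive (≡.cong (pow ζ) u≡v)) (sym (pow-% v)))

  eq≈pow : ∀ {d} a → suc d ∣ x → eq x ζ (suc d) (+ a) ≈ pow ζ (a ℕ.* (x / suc d))
  eq≈pow a D∣x = pow-cong-% ([m%n]*[x/n]%x≡m*[x/n]%x a D∣x)

  geometric : ℕ → Carrier
  geometric A = ΣR x (λ l → pow ζ (l ℕ.* A))

  geometric-∣ : ∀ {A} → x ∣ A → geometric A ≈ fromℕ x
  geometric-∣ {A} x∣A = ΣR-one x λ l _ _ → begin
    pow ζ (l ℕ.* A)       ≈⟨ pow-% (l ℕ.* A) ⟩
    pow ζ (l ℕ.* A % x)   ≡⟨ ≡.cong (pow ζ) (n∣m⇒m%n≡0 (l ℕ.* A) x (∣n⇒∣m*n l x∣A)) ⟩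
    1#                    ∎

  pow*geometric : ∀ A → pow ζ A * geometric A ≈ geometric A
  pow*geometric A = +-cancelʳ (g 1) _ _ (begin
    pow ζ A * geometric A + g 1             ≈⟨ +-congʳ (*-distribˡ-ΣR x (pow ζ A) g) ⟩
    ΣR x (λ l → pow ζ A * g l) + g 1        ≈⟨ +-congʳ (ΣR-cong x λ l _ _ → sym (pow-+ ζ A (l ℕ.* A))) ⟩
    ΣR x (λ l → g (suc l)) + g 1            ≈⟨ ΣR-shift x g ⟩
    geometric A + g (suc x)                 ≈⟨ +-congˡ (pow-cong-% [1+x]A≡1A) ⟩
    geometric A + g 1                       ∎)
    where
    [1+x]A≡1A : (suc x ℕ.* A) % x ≡ (1 ℕ.* A) % x
    [1+x]A≡1A = ≡.trans (≡.cong (λ u → (A ℕ.+ u) % x) (ℕ.*-comm x A))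
                (≡.trans ([m+kn]%n≡m%n A A x) (≡.cong (_% x) (≡.sym (ℕ.+-identityʳ A))))
    g : ℕ → Carrier
    g l = pow ζ (l ℕ.* A)

  geometric-∤ : IsIntegralDomain → (∀ d → 0 ℕ.< d → d ℕ.< x → ¬ pow ζ d ≈ 1#) →
                ∀ {A} → ¬ x ∣ A → geometric A ≈ 0#
  geometric-∤ (_ , no-zero-divisors) ζ-primitive {A} x∤A =
    [ (λ ζᴬ-1≈0 → contradiction (trans (sym (pow-% A)) (x∙y⁻¹≈ε⇒x≈y _ _ ζᴬ-1≈0))
                                (ζ-primitive (A % x) 0<A%x (m%n<n A x)))
    , id ] (no-zero-divisors (pow ζ A - 1#) (geometric A) annihilated)
    where
    annihilated : (pow ζ A - 1#) * geometric A ≈ 0#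
    annihilated = begin
      (pow ζ A - 1#) * geometric A               ≈⟨ [y-z]x≈yx-zx (geometric A) (pow ζ A) 1# ⟩
      pow ζ A * geometric A - 1# * geometric A   ≈⟨ +-cong (pow*geometric A) (-‿cong (*-identityˡ _)) ⟩
      geometric A - geometric A                  ≈⟨ -‿inverseʳ (geometric A) ⟩
      0#                                         ∎
    0<A%x : 0 ℕ.< A % x
    0<A%x = ℕ.n≢0⇒n>0 λ A%x≡0 → x∤A (m%n≡0⇒n∣m A x A%x≡0)

module KloostermanSquare {c ℓ} (R : CommutativeRing c ℓ) (domain : Sums.IsIntegralDomain R)
                         (Q : ℕ) (ζ : CommutativeRing.Carrier R)
                         (ζ-primitive : Sums.IsPrimitiveRoot R (lcmUpTo Q) ζ) (m n : ℕ) where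

  open CommutativeRing R
  open Sums R

  open import Data.Nat as ℕ using (zero; suc; z≤n; s≤s; _/_)
  import Data.Nat.Properties as ℕ
  open import Data.Nat.Divisibility using (_∣_; _∣?_)
  open import Data.Nat.Coprimality using (Coprime; coprime?)
  open import Data.Integer as ℤ using (+_)
  open import Data.Bool using (if_then_else_)
  open import Data.List using (_∷_; [])
  open import Data.Nat.Tactic.RingSolver using (solve)
  open import Data.Product using (_×_; _,_; proj₁; proj₂)
  open import Function using (case_of_)
  open import Relation.Binary.PropositionalEquality as ≡ using (_≡_)
  open import Relation.Nullary using (¬_; yes; no; contradiction)
  open import Relation.Nullary.Decidable using (⌊_⌋; dec-yes; dec-no)
  open import Relation.Binary.Reasoning.Setoid setoid
  open Arithmetic
  open SumsProperties R

  x : ℕ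
  x = lcmUpTo Q

  instance
    x-nonZero : NonZero x
    x-nonZero = lcmUpTo-nonZero Q

  open RootOfUnity R x ζ (proj₁ ζ-primitive)

  ifCoprime : ℕ → ℕ → Carrier → Carrier
  ifCoprime k q v = if ⌊ coprime? k q ⌋ then v else 0#

  ifCoprime-yes : ∀ {k q} v → Coprime k q → ifCoprime k q v ≡ v
  ifCoprime-yes {k} {q} v k⊥q = ≡.cong (λ d → if ⌊ d ⌋ then v else 0#) (proj₂ (dec-yes (coprime? k q) k⊥q))

  ifCoprime-no : ∀ {k q} v → ¬ Coprime k q → ifCoprime k q v ≡ 0#
  ifCoprime-no {k} {q} v k⊥̸q = ≡.cong (λ d → if ⌊ d ⌋ then v else 0#) (dec-no (coprime? k q) k⊥̸q)

  kloostermanTerm : ℕ → ℕ → ℕ → ℕ → Carrier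
  kloostermanTerm a b q k = ifCoprime k q (eq x ζ q (+ (a ℕ.* k ℕ.+ b ℕ.* invMod q k)))

  ramanujanTerm : ℕ → ℕ → Carrier
  ramanujanTerm q k = ifCoprime k q (eq x ζ q ((+ m ℤ.- + n) ℤ.* + k))

  middleSum : ℕ → ℕ → ℕ → ℕ → Carrier
  middleSum q k r j = ΣR x (λ l → kloostermanTerm m l q k * kloostermanTerm l n r j)

  Ysq≈Σ₂middleSum : Ysq ζ Q m n ≈ Σ₂ Q (λ q k → Σ₂ Q (middleSum q k))
  Ysq≈Σ₂middleSum = begin
    ΣR x (λ l → Σ₂ Q (kloostermanTerm m l) * Σ₂ Q (kloostermanTerm l n))
      ≈⟨ ΣR-cong x (λ l _ _ → Σ₂-* Q (kloostermanTerm m l) (kloostermanTerm l n)) ⟩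
    ΣR x (λ l → Σ₂ Q (λ q k → Σ₂ Q (λ r j → kloostermanTerm m l q k * kloostermanTerm l n r j)))
      ≈⟨ ΣR-Σ₂-swap x Q _ ⟩
    Σ₂ Q (λ q k → ΣR x (λ l → Σ₂ Q (λ r j → kloostermanTerm m l q k * kloostermanTerm l n r j)))
      ≈⟨ Σ₂-cong Q (λ q k _ _ _ → ΣR-Σ₂-swap x Q _) ⟩
    Σ₂ Q (λ q k → Σ₂ Q (middleSum q k)) ∎

  middleSum-coprime : ∀ {d e k j} → suc d ∣ x → suc e ∣ x → Coprime k (suc d) → Coprime j (suc e) →
    middleSum (suc d) k (suc e) j ≈
      pow ζ (m ℕ.* k ℕ.* (x / suc d) ℕ.+ n ℕ.* invMod (suc e) j ℕ.* (x / suc e))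
      * geometric (invMod (suc d) k ℕ.* (x / suc d) ℕ.+ j ℕ.* (x / suc e))
  middleSum-coprime {d} {e} {k} {j} D∣x E∣x k⊥D j⊥E = begin
    ΣR x (λ l → kloostermanTerm m l (suc d) k * kloostermanTerm l n (suc e) j) ≈⟨ ΣR-cong x (λ l _ _ → term l) ⟩
    ΣR x (λ l → pow ζ C * pow ζ (l ℕ.* A))                                     ≈⟨ *-distribˡ-ΣR x (pow ζ C) _ ⟨
    pow ζ C * geometric A                                                       ∎
    where
    i = invMod (suc d) k
    i′ = invMod (suc e) j
    u = x / suc d
    w = x / suc e
    C = m ℕ.* k ℕ.* u ℕ.+ n ℕ.* i′ ℕ.* w
    A = i ℕ.* u ℕ.+ j ℕ.* w
    regroup : ∀ m k l i u j n i′ w → (m ℕ.* k ℕ.+ l ℕ.* i) ℕ.* u ℕ.+ (l ℕ.* j ℕ.+ n ℕ.* i′) ℕ.* w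
                                     ≡ (m ℕ.* k ℕ.* u ℕ.+ n ℕ.* i′ ℕ.* w) ℕ.+ l ℕ.* (i ℕ.* u ℕ.+ j ℕ.* w)
    regroup m k l i u j n i′ w = solve (m ∷ k ∷ l ∷ i ∷ u ∷ j ∷ n ∷ i′ ∷ w ∷ [])
    term : ∀ l → kloostermanTerm m l (suc d) k * kloostermanTerm l n (suc e) j ≈ pow ζ C * pow ζ (l ℕ.* A)
    term l = begin
      kloostermanTerm m l (suc d) k * kloostermanTerm l n (suc e) j
        ≡⟨ ≡.cong₂ _*_ (ifCoprime-yes _ k⊥D) (ifCoprime-yes _ j⊥E) ⟩
      eq x ζ (suc d) (+ (m ℕ.* k ℕ.+ l ℕ.* i)) * eq x ζ (suc e) (+ (l ℕ.* j ℕ.+ n ℕ.* i′))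
        ≈⟨ *-cong (eq≈pow (m ℕ.* k ℕ.+ l ℕ.* i) D∣x) (eq≈pow (l ℕ.* j ℕ.+ n ℕ.* i′) E∣x) ⟩
      pow ζ ((m ℕ.* k ℕ.+ l ℕ.* i) ℕ.* u) * pow ζ ((l ℕ.* j ℕ.+ n ℕ.* i′) ℕ.* w)
        ≈⟨ pow-+ ζ ((m ℕ.* k ℕ.+ l ℕ.* i) ℕ.* u) ((l ℕ.* j ℕ.+ n ℕ.* i′) ℕ.* w) ⟨
      pow ζ ((m ℕ.* k ℕ.+ l ℕ.* i) ℕ.* u ℕ.+ (l ℕ.* j ℕ.+ n ℕ.* i′) ℕ.* w)
        ≡⟨ ≡.cong (pow ζ) (regroup m k l i u j n i′ w) ⟩
      pow ζ (C ℕ.+ l ℕ.* A)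
        ≈⟨ pow-+ ζ C (l ℕ.* A) ⟩
      pow ζ C * pow ζ (l ℕ.* A) ∎

  middleSum-not-coprimeˡ : ∀ {q k r j} → ¬ Coprime k q → middleSum q k r j ≈ 0#
  middleSum-not-coprimeˡ k⊥̸q = ΣR-zero x λ l _ _ → trans (*-congʳ (reflexive (ifCoprime-no _ k⊥̸q))) (zeroˡ _)

  middleSum-not-coprimeʳ : ∀ {q k r j} → ¬ Coprime j r → middleSum q k r j ≈ 0#
  middleSum-not-coprimeʳ j⊥̸r = ΣR-zero x λ l _ _ → trans (*-congˡ (reflexive (ifCoprime-no _ j⊥̸r))) (zeroʳ _)

  module _ {d k} (D≤Q : suc d ℕ.≤ Q) (k⊥D : Coprime k (suc d)) where

    private
      D∣x : suc d ∣ x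
      D∣x = ∣lcmUpTo Q (s≤s z≤n) D≤Q
      i = invMod (suc d) k
      J = negMod d i

    middleSum-diagonal : middleSum (suc d) k (suc d) J ≈ fromℕ x * eq x ζ (suc d) ((+ m ℤ.- + n) ℤ.* + k)
    middleSum-diagonal = begin
      middleSum (suc d) k (suc d) J
        ≈⟨ middleSum-coprime {d} {d} {k} {J} D∣x D∣x k⊥D (negMod-coprime (invMod-coprime k⊥D)) ⟩
      pow ζ C * geometric A
        ≈⟨ *-congˡ (geometric-∣ (∣⇒fractions-∣ {i = i} {J} D∣x (∣+negMod d i))) ⟩
      pow ζ C * fromℕ x                   ≈⟨ *-comm _ _ ⟩
      fromℕ x * pow ζ C                   ≈⟨ *-congˡ phase ⟨
      fromℕ x * eq x ζ (suc d) ((+ m ℤ.- + n) ℤ.* + k) ∎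
      where
      i′ = invMod (suc d) J
      A = i ℕ.* (x / suc d) ℕ.+ J ℕ.* (x / suc d)
      C = m ℕ.* k ℕ.* (x / suc d) ℕ.+ n ℕ.* i′ ℕ.* (x / suc d)
      phase : eq x ζ (suc d) ((+ m ℤ.- + n) ℤ.* + k) ≈ pow ζ C
      phase = begin
        eq x ζ (suc d) ((+ m ℤ.- + n) ℤ.* + k)
          ≡⟨ ≡.cong (λ r → pow ζ (r ℕ.* (x / suc d))) (kloosterman-phase m n k⊥D) ⟨
        eq x ζ (suc d) (+ (m ℕ.* k ℕ.+ n ℕ.* i′))
          ≈⟨ eq≈pow (m ℕ.* k ℕ.+ n ℕ.* i′) D∣x ⟩
        pow ζ ((m ℕ.* k ℕ.+ n ℕ.* i′) ℕ.* (x / suc d))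
          ≡⟨ ≡.cong (pow ζ) (ℕ.*-distribʳ-+ (x / suc d) (m ℕ.* k) (n ℕ.* i′)) ⟩
        pow ζ C ∎

    middleSum-off-diagonal : ∀ r j → 1 ℕ.≤ j → j ℕ.≤ r → r ℕ.≤ Q → ¬ (r ≡ suc d × j ≡ J) →
                             middleSum (suc d) k r j ≈ 0#
    middleSum-off-diagonal zero    zero () _ _ _
    middleSum-off-diagonal (suc e) j 1≤j j≤E E≤Q off = case coprime? j (suc e) of λ where
        (no j⊥̸E)  → middleSum-not-coprimeʳ {suc d} {k} j⊥̸E
        (yes j⊥E) → case x ∣? (i ℕ.* (x / suc d) ℕ.+ j ℕ.* (x / suc e)) of λ where
          (no x∤A)  → trans (middleSum-coprime D∣x E∣x k⊥D j⊥E)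
                            (trans (*-congˡ (geometric-∤ domain (proj₂ ζ-primitive) x∤A)) (zeroʳ _))
          (yes x∣A) → let D≡E , D∣i+j = fractions-∣⇒ D∣x E∣x (invMod-coprime k⊥D) j⊥E x∣A in
            contradiction (≡.sym D≡E , negMod-unique d i 1≤j (≡.subst (j ℕ.≤_) (≡.sym D≡E) j≤E) D∣i+j) off
      where
      E∣x : suc e ∣ x
      E∣x = ∣lcmUpTo Q (s≤s z≤n) E≤Q

  Σ₂middleSum : ∀ q k → 1 ℕ.≤ k → k ℕ.≤ q → q ℕ.≤ Q → Σ₂ Q (middleSum q k) ≈ fromℕ x * ramanujanTerm q k
  Σ₂middleSum zero    zero () _ _
  Σ₂middleSum (suc d) k _  _ D≤Q = case coprime? k (suc d) of λ where
      (no k⊥̸D)  → begin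
        Σ₂ Q (middleSum (suc d) k)
          ≈⟨ ΣR-zero Q (λ r _ _ → ΣR-zero r λ j _ _ → middleSum-not-coprimeˡ {r = r} {j} k⊥̸D) ⟩
        0#
          ≈⟨ zeroʳ (fromℕ x) ⟨
        fromℕ x * 0#
          ≡⟨ ≡.cong (fromℕ x *_) (ifCoprime-no _ k⊥̸D) ⟨
        fromℕ x * ramanujanTerm (suc d) k ∎
      (yes k⊥D) → begin
        Σ₂ Q (middleSum (suc d) k)
          ≈⟨ Σ₂-delta Q (negMod-positive d i) (negMod-≤ d i) D≤Q (middleSum-off-diagonal D≤Q k⊥D) ⟩
        middleSum (suc d) k (suc d) (negMod d i)
          ≈⟨ middleSum-diagonal D≤Q k⊥D ⟩
        fromℕ x * eq x ζ (suc d) ((+ m ℤ.- + n) ℤ.* + k)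
          ≡⟨ ≡.cong (fromℕ x *_) (ifCoprime-yes _ k⊥D) ⟨
        fromℕ x * ramanujanTerm (suc d) k ∎
    where
    i = invMod (suc d) k

lemma12 : {c ℓ : Level} (R : CommutativeRing c ℓ) → Sums.IsIntegralDomain R →
          (Q : ℕ) → 1 ≤ Q → (ζ : CommutativeRing.Carrier R) →
          Sums.IsPrimitiveRoot R (lcmUpTo Q) ζ →
          (m n : ℕ) → 1 ≤ m → m ≤ lcmUpTo Q → 1 ≤ n → n ≤ lcmUpTo Q →
          CommutativeRing._≈_ R (Sums.Ysq R ζ Q m n)
            (CommutativeRing._*_ R (Sums.fromℕ R (lcmUpTo Q)) (Sums.Xmat R ζ Q m n))
lemma12 R domain Q _ ζ ζ-primitive m n _ _ _ _ = begin
  Ysq ζ Q m n                                       ≈⟨ Ysq≈Σ₂middleSum ⟩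
  Σ₂ Q (λ q k → Σ₂ Q (middleSum q k))               ≈⟨ Σ₂-cong Q Σ₂middleSum ⟩
  Σ₂ Q (λ q k → fromℕ x * ramanujanTerm q k)        ≈⟨ *-distribˡ-Σ₂ Q (fromℕ x) ramanujanTerm ⟨
  fromℕ x * Xmat ζ Q m n                            ∎
  where
  open CommutativeRing R
  open Sums R
  open SumsProperties R
  open KloostermanSquare R domain Q ζ ζ-primitive m n
  open import Relation.Binary.Reasoning.Setoid setoid
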